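{- Let $K,s$ be given and let $T$ be a $(K,s)$-tree. Let $u_1,\dots,u_t$ be vertices of $T$ such that $u_{i+1}=r(u_i)$ for each $i\in[t-1]$. Let $Q=D_T[u_1]\cup\dots\cup D_T[u_t]$ and let $T^*$ be the rooted ordered tree obtained from $T[Q]$ (with the orderings of children inherited from $T$) by adding a new root vertex $v$ adjacent to $u_1,\dots,u_t$, whose children in left-to-right order are $u_1,\dots,u_t$. Then (1) $T^*$ is a $(K,s)$-tree, and (2) if $u_1^*=u_t^*$ or $u_1^*=l(u_t^*)$, then for all integers $h\geq 0$, $G^h_{T^*}$ is isomorphic to a subgraph of $G^h_T[Q\cup\{u_t^*\}]$, where $v$ is mapped to $u_t^*$.
   Context: All trees are rooted with children of each vertex ordered left to right; such a tree is DFS-ordered, i.e. its vertices are linearly ordered by DFS preorder traversal (visit root, then recursively the subtrees of its children from left to right). The level $L(u)$ of $u$ is its distance to the root; a cousin of $u$ is another vertex of the same level; $u^*$ denotes the parent of $u$; siblings share a parent. For vertices of the same level, "left" means earlier in the DFS order. $D_T[u]$ is the set of descendants of $u$ including $u$, $D_T(u)=D_T[u]\setminus\{u\}$, and $\nu(u)=|D_T[u]|$. The nearest left-cousin $l(u)$ is the last (in DFS order) cousin of $u$ preceding $u$; the nearest right-cousin $r(u)$ is the first cousin following $u$ (each when it exists). The $h$-th ancestor of $u$ is the vertex at distance $h$ from $u$ on the path to the root, or the root if $h>L(u)$. A DFS-ordered tree $T$ is a $(K,s)$-tree if for every vertex $u$: (T1) if $l(l(u))$ exists then $\nu(l(l(u)))+\nu(l(u))\geq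 \nu(u)$; (T2) if $l(u)$ exists then $\nu(l(u))\geq \nu(u)/K$; (T3) if $u$ is not the rightmost vertex on its level then $\nu(u)\geq\nu(u')$ for every vertex $u'$ with $L(u')\geq L(u)+s$; (T4) if $u$ has a child then $l(u)$ has a child (when $l(u)$ exists). For $h\geq0$, $\overrightarrow{G}^h_T$ is the digraph on $V(T)$ where for every vertex $u$ we add arcs: (G1) $u\to w$ for all $w\in D_T(u)$; (G2) $u\to w$ for every left-sibling $w$ of $u$ and $u\to w'$ for all $w'\in D_T(w)$; (G3) $u\to w$ for $w=l(u^*)$ and $u\to w'$ for all $w'\in D_T(w)$; (G4) letting $u'$ be the $h$-th ancestor of $u$: $u\to u'$, $u\to w$ for each existing $w\in\{l(u'),r(u')\}$, and $u\to w$ for all $w\in D_T(l(u'))\cup D_T(u')\cup D_T(r(u'))$ with $L(w)\leq L(u)$. $G^h_T$ is the underlying simple undirected graph of $\overrightarrow{G}^h_T$.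
   Formalization: The parameter $K$ of a $(K,s)$-tree is taken to be a nonzero rational number. -}

module Defs where

open import Data.Nat as ℕ using (ℕ; zero; suc; _+_; _∸_; _<_; _≤_)
open import Data.Integer as ℤ using (ℤ; +_)
open import Data.Rational as ℚ using (ℚ; _÷_; NonZero)
open import Data.List using (List; []; _∷_; _++_; [_]; length; take; mapMaybe)
open import Data.List.Relation.Unary.Any using (Any)
open import Data.Maybe using (Maybe; just; nothing; maybe)
open import Data.Product using (Σ; ∃; _×_; _,_)
open import Data.Sum using (_⊎_)
open import Relation.Binary.PropositionalEquality using (_≡_; _≢_)
open import Relation.Nullary using (¬_)

data Tree : Set where
  node : List Tree → Tree

-- A position is the path of child indices from the root
-- (the root is [], the i-th child (0-based) of p is p ++ [ i ]).
Pos : Set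
Pos = List ℕ

at  : Tree → Pos → Maybe Tree
atL : List Tree → ℕ → Pos → Maybe Tree
at t [] = just t
at (node ts) (i ∷ p) = atL ts i p
atL [] _ _ = nothing
atL (t ∷ ts) zero p = at t p
atL (t ∷ ts) (suc i) p = atL ts i p

size  : Tree → ℕ
sizeL : List Tree → ℕ
size (node ts) = suc (sizeL ts)
sizeL [] = 0
sizeL (t ∷ ts) = size t + sizeL ts

Vertex : Tree → Pos → Set
Vertex T p = ∃ λ t → at T p ≡ just t

ν : Tree → Pos → ℕ
ν T u = maybe size 0 (at T u)

L : Pos → ℕ
L = length

-- DFS preorder: a vertex precedes its descendants, and subtrees of
-- left children precede subtrees of right children.
data _≺_ : Pos → Pos → Set where
  root≺ : ∀ {i q} → [] ≺ (i ∷ q)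
  here  : ∀ {i j p q} → i < j → (i ∷ p) ≺ (j ∷ q)
  there : ∀ {i p q} → p ≺ q → (i ∷ p) ≺ (i ∷ q)

_⊑_ : Pos → Pos → Set
u ⊑ w = ∃ λ q → w ≡ u ++ q

_⊏_ : Pos → Pos → Set
u ⊏ w = ∃ λ i → ∃ λ q → w ≡ u ++ (i ∷ q)

Parent : Pos → Pos → Set
Parent u p = ∃ λ i → u ≡ p ++ [ i ]

IsL : Tree → Pos → Pos → Set
IsL T w u = Vertex T u × Vertex T w × L w ≡ L u × w ≺ u ×
  (∀ x → Vertex T x → L x ≡ L u → w ≺ x → ¬ (x ≺ u))

IsR : Tree → Pos → Pos → Set
IsR T w u = Vertex T u × Vertex T w × L w ≡ L u × u ≺ w ×
  (∀ x → Vertex T x → L x ≡ L u → u ≺ x → ¬ (x ≺ w))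

HasChild : Tree → Pos → Set
HasChild T u = Vertex T (u ++ [ 0 ])

NotRightmost : Tree → Pos → Set
NotRightmost T u = ∃ λ x → Vertex T x × L x ≡ L u × u ≺ x

ℕ→ℚ : ℕ → ℚ
ℕ→ℚ n = (+ n) ℚ./ 1

record KsTree (K : ℚ) .{{_ : NonZero K}} (s : ℤ) (T : Tree) : Set where
  field
    T1 : ∀ u a b → IsL T a u → IsL T b a → ν T u ≤ ν T b + ν T a
    T2 : ∀ u a → IsL T a u → (ℕ→ℚ (ν T u) ÷ K) ℚ.≤ ℕ→ℚ (ν T a)
    T3 : ∀ u → Vertex T u → NotRightmost T u →
         ∀ u' → Vertex T u' → (+ L u ℤ.+ s) ℤ.≤ + L u' → ν T u' ≤ ν T u
    T4 : ∀ u a → IsL T a u → HasChild T u → HasChild T a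

-- h-th ancestor (the root if h > L(u)).
anc : ℕ → Pos → Pos
anc h u = take (L u ∸ h) u

data Arc (T : Tree) (h : ℕ) (u w : Pos) : Set where
  G1 : u ⊏ w → Arc T h u w
  G2 : ∀ p i j → j < i → u ≡ p ++ [ i ] → Vertex T (p ++ [ j ]) →
       (w ≡ p ++ [ j ] ⊎ (p ++ [ j ]) ⊏ w) → Arc T h u w
  G3 : ∀ p x → Parent u p → IsL T x p → (w ≡ x ⊎ x ⊏ w) → Arc T h u w
  G4a : w ≡ anc h u → Arc T h u w
  G4b : IsL T w (anc h u) ⊎ IsR T w (anc h u) → Arc T h u w
  G4c : ∀ x → (IsL T x (anc h u) ⊎ x ≡ anc h u ⊎ IsR T x (anc h u)) →
        x ⊏ w → L w ≤ L u → Arc T h u w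

Edge : Tree → ℕ → Pos → Pos → Set
Edge T h a b = Vertex T a × Vertex T b × a ≢ b × (Arc T h a b ⊎ Arc T h b a)

-- T*: new root v whose children, left to right, are the subtrees of T
-- rooted at u₁,…,u_t (all of which are assumed to be vertices).

star : Tree → List Pos → Tree
star T us = node (mapMaybe (at T) us)

InQ : List Pos → Pos → Set
InQ us x = Any (λ u → u ⊑ x) us

{-# OPTIONS --safe #-}
-- The vertex i ∷ q of T* is the vertex φ (i ∷ q) = u_i ++ q of T.  Because
-- u₁, …, u_t are consecutive cousins, Q meets every level in an interval of the
-- DFS order, so φ preserves the DFS order, subtree sizes, children and nearest
-- cousins away from the root of T*.  Hence T1, T2 and T4 carry over from T, and
-- so does T3 except at the new root v, where it would force s < 0, whereas T3
-- in T forces s ≥ 0 as soon as T has a non-rightmost vertex.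
--
-- For the embedding, φ sends v to pt = u_t^*.  Every u_i has parent p₁ or pt,
-- and by T4 the parents of a vertex and of its nearest left cousin are equal or
-- nearest cousins again; iterating, the ancestors of p₁ and pt on each level
-- are equal or nearest cousins.  This turns the arcs involving v or two of its
-- children (G1 from v, G2 between the u_i, G4 with h-th ancestor v) into arcs
-- of G^h_T at pt, while all other arcs of G^h_{T*} are arcs of G^h_T verbatim.
module Submission where

open import Defs
open import Data.Nat using (ℕ; zero; suc; _+_; _∸_; _<_; _≤_; z≤n; s≤s)
import Data.Nat.Properties as ℕP
open import Data.List using (List; []; _∷_; _++_; [_]; length; take; drop; map; mapMaybe; initLast; _∷ʳ′_)
import Data.List.Properties as ListP
open import Data.List.Membership.Propositional using (_∈_)
import Data.List.Membership.Propositional.Properties as ∈P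
open import Data.List.Relation.Unary.All using (All; []; _∷_)
open import Data.List.Relation.Unary.Any using (Any; here; there)
open import Data.List.Relation.Unary.Linked using (Linked; [-]; _∷_)
open import Data.List.NonEmpty using (last)
open import Data.Maybe using (Maybe; just; nothing; maybe)
import Data.Maybe.Properties as MaybeP
open import Data.Product using (Σ; ∃; ∃₂; _×_; _,_; proj₁; proj₂)
open import Data.Sum using (_⊎_; inj₁; inj₂) renaming (map to ⊎-map)
open import Data.Empty using (⊥; ⊥-elim)
open import Relation.Nullary using (¬_; Dec; yes; no)
open import Relation.Binary using (tri<; tri≈; tri>)
open import Relation.Binary.PropositionalEquality hiding ([_])
open import Data.Integer as ℤ using (ℤ; +_)
import Data.Integer.Properties as ℤP
open import Data.Rational as ℚ using (ℚ; NonZero)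

-- DFS order

_≼_ : Pos → Pos → Set
p ≼ q = p ≡ q ⊎ p ≺ q

≺-irrefl : ∀ {p} → ¬ (p ≺ p)
≺-irrefl (here i<i) = ℕP.<-irrefl refl i<i
≺-irrefl (there p≺p) = ≺-irrefl p≺p

≺-trans : ∀ {p q r} → p ≺ q → q ≺ r → p ≺ r
≺-trans root≺ (here _) = root≺
≺-trans root≺ (there _) = root≺
≺-trans (here i<j) (here j<k) = here (ℕP.<-trans i<j j<k)
≺-trans (here i<j) (there _) = here i<j
≺-trans (there _) (here j<k) = here j<k
≺-trans (there p≺q) (there q≺r) = there (≺-trans p≺q q≺r)

≺-asym : ∀ {p q} → p ≺ q → ¬ (q ≺ p)
≺-asym p≺q q≺p = ≺-irrefl (≺-trans p≺q q≺p)

≺-compare : ∀ p q → p ≺ q ⊎ p ≡ q ⊎ q ≺ p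
≺-compare [] [] = inj₂ (inj₁ refl)
≺-compare [] (_ ∷ _) = inj₁ root≺
≺-compare (_ ∷ _) [] = inj₂ (inj₂ root≺)
≺-compare (i ∷ p) (j ∷ q) with ℕP.<-cmp i j
... | tri< i<j _ _ = inj₁ (here i<j)
... | tri> _ _ j<i = inj₂ (inj₂ (here j<i))
... | tri≈ _ refl _ with ≺-compare p q
...   | inj₁ p≺q = inj₁ (there p≺q)
...   | inj₂ (inj₁ refl) = inj₂ (inj₁ refl)
...   | inj₂ (inj₂ q≺p) = inj₂ (inj₂ (there q≺p))

_≺?_ : ∀ p q → Dec (p ≺ q)
p ≺? q with ≺-compare p q
... | inj₁ p≺q = yes p≺q
... | inj₂ (inj₁ refl) = no ≺-irrefl
... | inj₂ (inj₂ q≺p) = no (≺-asym q≺p)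

≼-≺-trans : ∀ {p q r} → p ≼ q → q ≺ r → p ≺ r
≼-≺-trans (inj₁ refl) q≺r = q≺r
≼-≺-trans (inj₂ p≺q) q≺r = ≺-trans p≺q q≺r

≺-≼-trans : ∀ {p q r} → p ≺ q → q ≼ r → p ≺ r
≺-≼-trans p≺q (inj₁ refl) = p≺q
≺-≼-trans p≺q (inj₂ q≺r) = ≺-trans p≺q q≺r

≼⇒¬≻ : ∀ {p q} → p ≼ q → ¬ (q ≺ p)
≼⇒¬≻ (inj₁ refl) = ≺-irrefl
≼⇒¬≻ (inj₂ p≺q) = ≺-asym p≺q

≺⇒nonempty : ∀ {p q} → p ≺ q → 0 < length q
≺⇒nonempty root≺ = s≤s z≤n
≺⇒nonempty (here _) = s≤s z≤n
≺⇒nonempty (there _) = s≤s z≤n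

++-monoʳ-≺ : ∀ (c : Pos) {p q} → p ≺ q → (c ++ p) ≺ (c ++ q)
++-monoʳ-≺ [] p≺q = p≺q
++-monoʳ-≺ (_ ∷ c) p≺q = there (++-monoʳ-≺ c p≺q)

≺-++⁺ : ∀ {a b} p q → length a ≡ length b → a ≺ b → (a ++ p) ≺ (b ++ q)
≺-++⁺ p q () root≺
≺-++⁺ p q _ (here i<j) = here i<j
≺-++⁺ p q |a|≡|b| (there a≺b) = there (≺-++⁺ p q (ℕP.suc-injective |a|≡|b|) a≺b)

≺-++⁻ : ∀ a b {p q} → length a ≡ length b → (a ++ p) ≺ (b ++ q) → a ≺ b ⊎ (a ≡ b × p ≺ q)
≺-++⁻ [] [] _ p≺q = inj₂ (refl , p≺q)
≺-++⁻ (i ∷ a) (j ∷ b) _ (here i<j) = inj₁ (here i<j)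
≺-++⁻ (i ∷ a) (.i ∷ b) |a|≡|b| (there a≺b) with ≺-++⁻ a b (ℕP.suc-injective |a|≡|b|) a≺b
... | inj₁ a≺b′ = inj₁ (there a≺b′)
... | inj₂ (refl , p≺q) = inj₂ (refl , p≺q)

≼-∷ʳ⁻ : ∀ a b {i j} → length a ≡ length b → (a ++ [ i ]) ≼ (b ++ [ j ]) → a ≼ b
≼-∷ʳ⁻ a b |a|≡|b| (inj₁ eq) = inj₁ (ListP.∷ʳ-injectiveˡ a b eq)
≼-∷ʳ⁻ a b |a|≡|b| (inj₂ a≺b) with ≺-++⁻ a b |a|≡|b| a≺b
... | inj₁ a≺b′ = inj₂ a≺b′
... | inj₂ (a≡b , _) = inj₁ a≡b

-- Paths and subtrees

∷ʳ-view : ∀ (b : Pos) → 0 < length b → ∃₂ λ b′ j → b ≡ b′ ++ [ j ]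
∷ʳ-view b 0<|b| with initLast b
... | b′ ∷ʳ′ j = b′ , j , refl

length-∷ʳ : ∀ (a : Pos) j → length (a ++ [ j ]) ≡ suc (length a)
length-∷ʳ a j = trans (ListP.length-++ a) (ℕP.+-comm (length a) 1)

∷ʳ-view₂ : ∀ (a b : Pos) → length a ≡ length b → 0 < length b →
  ∃₂ λ a′ j → ∃₂ λ b′ i → a ≡ a′ ++ [ j ] × b ≡ b′ ++ [ i ] × length a′ ≡ length b′
∷ʳ-view₂ a b |a|≡|b| 0<|b| with ∷ʳ-view a (subst (0 <_) (sym |a|≡|b|) 0<|b|) | ∷ʳ-view b 0<|b|
... | a′ , j , refl | b′ , i , refl =
  a′ , j , b′ , i , refl , refl , ℕP.suc-injective (trans (sym (length-∷ʳ a′ j)) (trans |a|≡|b| (length-∷ʳ b′ i)))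

++-cancel-≡length : ∀ (a b : Pos) {p q} → length a ≡ length b → a ++ p ≡ b ++ q → a ≡ b × p ≡ q
++-cancel-≡length [] [] _ eq = refl , eq
++-cancel-≡length (i ∷ a) (j ∷ b) |a|≡|b| eq with ListP.∷-injective eq
... | refl , eq′ with ++-cancel-≡length a b (ℕP.suc-injective |a|≡|b|) eq′
...   | refl , p≡q = refl , p≡q

take-++-≤ : ∀ n (a b : Pos) → n ≤ length a → take n (a ++ b) ≡ take n a
take-++-≤ zero a b _ = refl
take-++-≤ (suc n) (x ∷ a) b (s≤s n≤|a|) = cong (x ∷_) (take-++-≤ n a b n≤|a|)

take-length-++ : ∀ (a b : Pos) n → take (length a + n) (a ++ b) ≡ a ++ take n b
take-length-++ [] b n = refl
take-length-++ (x ∷ a) b n = cong (x ∷_) (take-length-++ a b n)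

take-⊏ : ∀ n (w : Pos) → n < length w → take n w ⊏ w
take-⊏ zero (x ∷ w) _ = x , w , refl
take-⊏ (suc n) (x ∷ w) (s≤s n<|w|) with take-⊏ n w n<|w|
... | i , q , eq = i , q , cong (x ∷_) eq

take-⊑ : ∀ n (a : Pos) → take n a ⊑ a
take-⊑ n a = drop n a , sym (ListP.take++drop≡id n a)

⊑-⊏-trans : ∀ {a b c} → a ⊑ b → b ⊏ c → a ⊏ c
⊑-⊏-trans {a} (q , refl) (i , r , refl) with q
... | [] = i , r , ListP.++-assoc a [] (i ∷ r)
... | x ∷ q′ = x , q′ ++ i ∷ r , ListP.++-assoc a (x ∷ q′) (i ∷ r)

⊏-∷ʳ-++ : ∀ (c : Pos) i r → c ⊏ ((c ++ [ i ]) ++ r)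
⊏-∷ʳ-++ c i r = i , r , ListP.++-assoc c [ i ] r

at-++ : ∀ t a {b t′} → at t a ≡ just t′ → at t (a ++ b) ≡ at t′ b
atL-++ : ∀ ts i a {b t′} → atL ts i a ≡ just t′ → atL ts i (a ++ b) ≡ at t′ b
at-++ t [] refl = refl
at-++ (node ts) (i ∷ a) eq = atL-++ ts i a eq
atL-++ (t ∷ ts) zero a eq = at-++ t a eq
atL-++ (t ∷ ts) (suc i) a eq = atL-++ ts i a eq

at-prefix : ∀ t a b {t′} → at t (a ++ b) ≡ just t′ → ∃ λ s → at t a ≡ just s
atL-prefix : ∀ ts i a b {t′} → atL ts i (a ++ b) ≡ just t′ → ∃ λ s → atL ts i a ≡ just s
at-prefix t [] b _ = t , refl
at-prefix (node ts) (i ∷ a) b eq = atL-prefix ts i a b eq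
atL-prefix (t ∷ ts) zero a b eq = at-prefix t a b eq
atL-prefix (t ∷ ts) (suc i) a b eq = atL-prefix ts i a b eq

Vertex-prefix : ∀ T a b → Vertex T (a ++ b) → Vertex T a
Vertex-prefix T a b (_ , eq) = at-prefix T a b eq

at-size : ∀ t p {t′} → at t p ≡ just t′ → size t′ ≤ size t
atL-size : ∀ ts i p {t′} → atL ts i p ≡ just t′ → size t′ ≤ sizeL ts
at-size t [] refl = ℕP.≤-refl
at-size (node ts) (i ∷ p) eq = ℕP.m≤n⇒m≤1+n (atL-size ts i p eq)
atL-size (t ∷ ts) zero p eq = ℕP.≤-trans (at-size t p eq) (ℕP.m≤m+n (size t) (sizeL ts))
atL-size (t ∷ ts) (suc i) p eq = ℕP.≤-trans (atL-size ts i p eq) (ℕP.m≤n+m (sizeL ts) (size t))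

ν-descendant-< : ∀ T w i q → Vertex T (w ++ (i ∷ q)) → ν T (w ++ (i ∷ q)) < ν T w
ν-descendant-< T w i q (t′ , eq) with at-prefix T w (i ∷ q) eq
... | node ts , eqw rewrite eq | eqw = s≤s (atL-size ts i q (trans (sym (at-++ T w eqw)) eq))

HasChild-parent : ∀ T p j → Vertex T (p ++ [ j ]) → HasChild T p
HasChild-parent T p j (t′ , eq) with at-prefix T p [ j ] eq
... | node ts , eqp rewrite at-++ T p {[ 0 ]} eqp = first-child ts (trans (sym (at-++ T p eqp)) eq)
  where
  first-child : ∀ ts {t′} → atL ts j [] ≡ just t′ → Vertex (node ts) [ 0 ]
  first-child (t ∷ _) _ = t , refl

Vertex? : ∀ T p → Dec (Vertex T p)
Vertex? T p with at T p
... | just t = yes (t , refl)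
... | nothing = no λ { (_ , ()) }

-- Nearest cousins

vertices : Tree → List Pos
verticesL : ℕ → List Tree → List Pos
vertices (node ts) = [] ∷ verticesL 0 ts
verticesL n [] = []
verticesL n (t ∷ ts) = map (n ∷_) (vertices t) ++ verticesL (suc n) ts

∈-vertices : ∀ t p {t′} → at t p ≡ just t′ → p ∈ vertices t
∈-verticesL : ∀ ts i q n {t′} → atL ts i q ≡ just t′ → (n + i) ∷ q ∈ verticesL n ts
∈-vertices (node ts) [] _ = here refl
∈-vertices (node ts) (i ∷ q) eq = there (∈-verticesL ts i q 0 eq)
∈-verticesL (t ∷ ts) zero q n eq rewrite ℕP.+-identityʳ n =
  ∈P.∈-++⁺ˡ (∈P.∈-map⁺ (n ∷_) (∈-vertices t q eq))
∈-verticesL (t ∷ ts) (suc i) q n eq rewrite ℕP.+-suc n i =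
  ∈P.∈-++⁺ʳ (map (n ∷_) (vertices t)) (∈-verticesL ts i q (suc n) eq)

≺-greatest : (P : Pos → Set) → (∀ x → Dec (P x)) → (xs : List Pos) →
  (∀ x → x ∈ xs → ¬ P x) ⊎ ∃ λ m → P m × (∀ y → y ∈ xs → P y → y ≼ m)
≺-greatest P P? [] = inj₁ λ _ ()
≺-greatest P P? (x ∷ xs) with ≺-greatest P P? xs | P? x
... | inj₁ none | no ¬px = inj₁ λ { y (here refl) → ¬px ; y (there y∈) → none y y∈ }
... | inj₁ none | yes px = inj₂ (x , px , λ { y (here refl) _ → inj₁ refl ; y (there y∈) py → ⊥-elim (none y y∈ py) })
... | inj₂ (m , pm , max) | no ¬px = inj₂ (m , pm , λ { y (here refl) py → ⊥-elim (¬px py) ; y (there y∈) py → max y y∈ py })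
... | inj₂ (m , pm , max) | yes px with ≺-compare m x
...   | inj₁ m≺x = inj₂ (x , px , λ { y (here refl) _ → inj₁ refl ; y (there y∈) py → inj₂ (≼-≺-trans (max y y∈ py) m≺x) })
...   | inj₂ (inj₁ refl) = inj₂ (m , pm , λ { y (here refl) _ → inj₁ refl ; y (there y∈) py → max y y∈ py })
...   | inj₂ (inj₂ x≺m) = inj₂ (m , pm , λ { y (here refl) _ → inj₂ x≺m ; y (there y∈) py → max y y∈ py })

IsL-exists : ∀ T p z → Vertex T p → Vertex T z → length z ≡ length p → z ≺ p →
  ∃ λ a → IsL T a p × z ≼ a
IsL-exists T p z vp vz |z|≡|p| z≺p with ≺-greatest Between Between? (vertices T)
  where
  Between : Pos → Set
  Between x = Vertex T x × length x ≡ length p × z ≼ x × x ≺ p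
  Between? : ∀ x → Dec (Between x)
  Between? x with Vertex? T x | length x ℕP.≟ length p | ListP.≡-dec ℕP._≟_ z x | z ≺? x | x ≺? p
  ... | no ¬vx | _ | _ | _ | _ = no λ b → ¬vx (proj₁ b)
  ... | yes _ | no ¬lx | _ | _ | _ = no λ b → ¬lx (proj₁ (proj₂ b))
  ... | yes _ | yes _ | _ | _ | no ¬x≺p = no λ b → ¬x≺p (proj₂ (proj₂ (proj₂ b)))
  ... | yes vx | yes lx | yes z≡x | _ | yes x≺p = yes (vx , lx , inj₁ z≡x , x≺p)
  ... | yes vx | yes lx | no _ | yes z≺x | yes x≺p = yes (vx , lx , inj₂ z≺x , x≺p)
  ... | yes _ | yes _ | no z≢x | no ¬z≺x | yes _ =
    no λ { (_ , _ , inj₁ z≡x , _) → z≢x z≡x ; (_ , _ , inj₂ z≺x , _) → ¬z≺x z≺x }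
... | inj₁ none = ⊥-elim (none z (∈-vertices T z (proj₂ vz)) (vz , |z|≡|p| , inj₁ refl , z≺p))
... | inj₂ (m , (vm , lm , z≼m , m≺p) , max) =
  m , (vp , vm , lm , m≺p , nearest) , z≼m
  where
  nearest : ∀ x → Vertex T x → length x ≡ length p → m ≺ x → ¬ (x ≺ p)
  nearest x vx lx m≺x x≺p =
    ≼⇒¬≻ (max x (∈-vertices T x (proj₂ vx)) (vx , lx , inj₂ (≼-≺-trans z≼m m≺x) , x≺p)) m≺x

IsL⇒IsR : ∀ {T a b} → IsL T a b → IsR T b a
IsL⇒IsR (vb , va , eq , a≺b , nearest) = va , vb , sym eq , a≺b , λ x vx lx → nearest x vx (trans lx eq)

IsR⇒IsL : ∀ {T a b} → IsR T b a → IsL T a b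
IsR⇒IsL (va , vb , eq , a≺b , nearest) = vb , va , sym eq , a≺b , λ x vx lx → nearest x vx (trans lx eq)

¬IsL-of-root : ∀ {T} a → ¬ IsL T a []
¬IsL-of-root [] (_ , _ , _ , () , _)
¬IsL-of-root (_ ∷ _) (_ , _ , () , _ , _)

¬root-IsL : ∀ {T} x → ¬ IsL T [] x
¬root-IsL [] (_ , _ , _ , () , _)
¬root-IsL (_ ∷ _) (_ , _ , () , _ , _)

root-has-no-cousin : ∀ {T} y → ¬ (IsL T y [] ⊎ IsR T y [])
root-has-no-cousin y (inj₁ l) = ¬IsL-of-root y l
root-has-no-cousin y (inj₂ r) = ¬root-IsL y (IsR⇒IsL r)

root-is-no-cousin : ∀ {T} y → ¬ (IsL T [] y ⊎ IsR T [] y)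
root-is-no-cousin y (inj₁ l) = ¬root-IsL y l
root-is-no-cousin y (inj₂ r) = ¬IsL-of-root y (IsR⇒IsL r)

root-rightmost : ∀ {T} → ¬ NotRightmost T []
root-rightmost ([] , _ , _ , ())
root-rightmost ((_ ∷ _) , _ , () , _)

anc-root : ∀ h → anc h [] ≡ []
anc-root zero = refl
anc-root (suc _) = refl

Adjacent : Tree → Pos → Pos → Set
Adjacent T x y = IsL T x y ⊎ x ≡ y ⊎ IsR T x y

Adjacent-[]ʳ : ∀ {T} x → Adjacent T x [] → x ≡ []
Adjacent-[]ʳ x (inj₁ l) = ⊥-elim (¬IsL-of-root x l)
Adjacent-[]ʳ x (inj₂ (inj₁ eq)) = eq
Adjacent-[]ʳ x (inj₂ (inj₂ r)) = ⊥-elim (¬root-IsL x (IsR⇒IsL r))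

¬Adjacent-[]ˡ : ∀ {T} i P → ¬ Adjacent T [] (i ∷ P)
¬Adjacent-[]ˡ i P (inj₁ l) = ¬root-IsL _ l
¬Adjacent-[]ˡ i P (inj₂ (inj₁ ()))
¬Adjacent-[]ˡ i P (inj₂ (inj₂ r)) = ¬IsL-of-root _ (IsR⇒IsL r)

-- (K,s)-trees

+[1+m]+i≤+m : ∀ m {i} → i ℤ.< + 0 → + suc m ℤ.+ i ℤ.≤ + m
+[1+m]+i≤+m m {+ _} (ℤ.+<+ ())
+[1+m]+i≤+m m {ℤ.-[1+ n ]} _ = ℤP.≤-trans (ℤP.≤-reflexive (ℤP.[1+m]⊖[1+n]≡m⊖n m n)) (ℤP.m⊖n≤m m n)

ℤ+-cancelˡ-≤ : ∀ i {j k} → i ℤ.+ j ℤ.≤ i ℤ.+ k → j ℤ.≤ k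
ℤ+-cancelˡ-≤ i {j} {k} i+j≤i+k = subst₂ ℤ._≤_ (cancel j) (cancel k) (ℤP.+-monoʳ-≤ (ℤ.- i) i+j≤i+k)
  where
  cancel : ∀ z → ℤ.- i ℤ.+ (i ℤ.+ z) ≡ z
  cancel z = trans (sym (ℤP.+-assoc (ℤ.- i) i z)) (trans (cong (ℤ._+ z) (ℤP.+-inverseˡ i)) (ℤP.+-identityˡ z))

level-gap-shift : ∀ s a b m n → + (a + m) ℤ.+ s ℤ.≤ + (a + n) → + (b + m) ℤ.+ s ℤ.≤ + (b + n)
level-gap-shift s a b m n gap =
  subst₂ ℤ._≤_ (sym (split b)) (sym (ℤP.pos-+ b n))
    (ℤP.+-monoʳ-≤ (+ b) (ℤ+-cancelˡ-≤ (+ a) {+ m ℤ.+ s} {+ n} (subst₂ ℤ._≤_ (split a) (ℤP.pos-+ a n) gap)))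
  where
  split : ∀ c → + (c + m) ℤ.+ s ≡ + c ℤ.+ (+ m ℤ.+ s)
  split c = trans (cong (ℤ._+ s) (ℤP.pos-+ c m)) (ℤP.+-assoc (+ c) (+ m) s)

module _ {K : ℚ} .{{_ : NonZero K}} {s : ℤ} {T : Tree} (ks : KsTree K s T) where
  open KsTree ks

  -- By T4, l(b) has a child; if a cousin strictly between a and b existed,
  -- the first child of l(b) would lie strictly between a ++ [ j ] and b ++ [ i ].
  IsL-parents : ∀ a i b j → IsL T (a ++ [ j ]) (b ++ [ i ]) → a ≡ b ⊎ IsL T a b
  IsL-parents a i b j (vbi , vaj , |aj|≡|bi| , aj≺bi , nearest) with ListP.≡-dec ℕP._≟_ a b
  ... | yes a≡b = inj₁ a≡b
  ... | no a≢b = inj₂ (vb , va , |a|≡|b| , a≺b , nearest′)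
    where
    vb = Vertex-prefix T b [ i ] vbi
    va = Vertex-prefix T a [ j ] vaj
    |a|≡|b| : length a ≡ length b
    |a|≡|b| = ℕP.suc-injective (trans (sym (length-∷ʳ a j)) (trans |aj|≡|bi| (length-∷ʳ b i)))
    a≺b : a ≺ b
    a≺b with ≺-++⁻ a b |a|≡|b| aj≺bi
    ... | inj₁ a≺b = a≺b
    ... | inj₂ (a≡b , _) = ⊥-elim (a≢b a≡b)
    nearest′ : ∀ x → Vertex T x → length x ≡ length b → a ≺ x → ¬ (x ≺ b)
    nearest′ z vz |z|≡|b| a≺z z≺b with IsL-exists T b z vb vz |z|≡|b| z≺b
    ... | w , lw@(_ , _ , |w|≡|b| , w≺b , _) , z≼w =
      nearest (w ++ [ 0 ]) (T4 b w lw (HasChild-parent T b i vbi))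
        (trans (length-∷ʳ w 0) (trans (cong suc |w|≡|b|) (sym (length-∷ʳ b i))))
        (≺-++⁺ [ j ] [ 0 ] (trans |a|≡|b| (sym |w|≡|b|)) (≺-≼-trans a≺z z≼w))
        (≺-++⁺ [ 0 ] [ i ] |w|≡|b| w≺b)

  IsL-ancestors : ∀ d n a b → length b ≡ n + d → IsL T a b →
    take n a ≡ take n b ⊎ IsL T (take n a) (take n b)
  IsL-ancestors zero n a b |b|≡n+0 lab@(_ , _ , |a|≡|b| , _) =
    inj₂ (subst₂ (IsL T) (sym (ListP.take-all n a (ℕP.≤-reflexive (trans |a|≡|b| |b|≡n))))
                          (sym (ListP.take-all n b (ℕP.≤-reflexive |b|≡n))) lab)
    where |b|≡n = trans |b|≡n+0 (ℕP.+-identityʳ n)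
  IsL-ancestors (suc d) n a b |b|≡n+1+d lab@(_ , _ , |a|≡|b| , _)
    with ∷ʳ-view₂ a b |a|≡|b| (subst (0 <_) (sym (trans |b|≡n+1+d (ℕP.+-suc n d))) (s≤s z≤n))
  ... | a′ , j , b′ , i , refl , refl , |a′|≡|b′| = step (IsL-parents a′ i b′ j lab)
    where
    |b′|≡n+d : length b′ ≡ n + d
    |b′|≡n+d = ℕP.suc-injective (trans (sym (length-∷ʳ b′ i)) (trans |b|≡n+1+d (ℕP.+-suc n d)))
    n≤|b′| : n ≤ length b′
    n≤|b′| = subst (n ≤_) (sym |b′|≡n+d) (ℕP.m≤m+n n d)
    step : a′ ≡ b′ ⊎ IsL T a′ b′ →
      take n (a′ ++ [ j ]) ≡ take n (b′ ++ [ i ]) ⊎ IsL T (take n (a′ ++ [ j ])) (take n (b′ ++ [ i ]))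
    step rewrite take-++-≤ n a′ [ j ] (subst (n ≤_) (sym |a′|≡|b′|) n≤|b′|) | take-++-≤ n b′ [ i ] n≤|b′| =
      λ { (inj₁ refl) → inj₁ refl ; (inj₂ la′b′) → IsL-ancestors d n a′ b′ |b′|≡n+d la′b′ }

  IsL-arc-to-descendants : ∀ h a b → IsL T a b → ∀ m r → Arc T h b (a ++ (m ∷ r))
  IsL-arc-to-descendants h a b lab@(_ , va , |a|≡|b| , a≺b , _) m r
    with ∷ʳ-view₂ a b |a|≡|b| (≺⇒nonempty a≺b)
  ... | a′ , j , b′ , i , refl , refl , _ with IsL-parents a′ i b′ j lab
  ...   | inj₁ refl = G2 a′ i j j<i refl va (inj₂ (m , r , refl))
    where
    j<i : j < i
    j<i with ≺-++⁻ a′ a′ refl a≺b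
    ... | inj₁ a′≺a′ = ⊥-elim (≺-irrefl a′≺a′)
    ... | inj₂ (_ , here j<i) = j<i
  ...   | inj₂ la′b′ = G3 b′ a′ (i , refl) la′b′ (inj₂ (j , m ∷ r , ListP.++-assoc a′ [ j ] (m ∷ r)))

  NotRightmost⇒s≥0 : ∀ y → Vertex T y → NotRightmost T y → + 0 ℤ.≤ s
  NotRightmost⇒s≥0 y vy nr with ∷ʳ-view y (nonempty y nr)
    where
    nonempty : ∀ y → NotRightmost T y → 0 < length y
    nonempty [] nr = ⊥-elim (root-rightmost nr)
    nonempty (_ ∷ _) _ = s≤s z≤n
  ... | y′ , i , refl = ℤP.≮⇒≥ λ s<0 →
    ℕP.<⇒≱ (ν-descendant-< T y′ i [] vy)
      (T3 (y′ ++ [ i ]) vy nr y′ (Vertex-prefix T y′ [ i ] vy)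
        (subst (λ l → + l ℤ.+ s ℤ.≤ + length y′) (sym (length-∷ʳ y′ i)) (+[1+m]+i≤+m (length y′) s<0)))

-- Chains of consecutive cousins

_‼_ : List Pos → ℕ → Maybe Pos
[] ‼ _ = nothing
(u ∷ us) ‼ zero = just u
(u ∷ us) ‼ suc i = us ‼ i

‼-All : ∀ {P : Pos → Set} {us} → All P us → ∀ i {w} → us ‼ i ≡ just w → P w
‼-All (pu ∷ _) zero refl = pu
‼-All (_ ∷ pus) (suc i) eq = ‼-All pus i eq

‼-Any : ∀ {P : Pos → Set} us i {w} → us ‼ i ≡ just w → P w → Any P us
‼-Any (u ∷ us) zero refl pw = here pw
‼-Any (u ∷ us) (suc i) eq pw = there (‼-Any us i eq pw)

lastOf : Pos → List Pos → Pos
lastOf u [] = u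
lastOf _ (v ∷ vs) = lastOf v vs

last≡lastOf : ∀ u vs → last (u Data.List.NonEmpty.∷ vs) ≡ lastOf u vs
last≡lastOf u vs with initLast vs
... | [] = refl
... | ys ∷ʳ′ y = sym (lastOf-∷ʳ u ys)
  where
  lastOf-∷ʳ : ∀ u vs → lastOf u (vs ++ [ y ]) ≡ y
  lastOf-∷ʳ u [] = refl
  lastOf-∷ʳ _ (v ∷ vs) = lastOf-∷ʳ v vs

‼-lastOf : ∀ u vs → ∃ λ i → (u ∷ vs) ‼ i ≡ just (lastOf u vs)
‼-lastOf u [] = 0 , refl
‼-lastOf _ (v ∷ vs) with ‼-lastOf v vs
... | i , eq = suc i , eq

module CousinChain (T : Tree) where

  Chain : List Pos → Set
  Chain = Linked (λ a b → IsR T b a)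

  chain-level : ∀ {u us} → Chain (u ∷ us) → ∀ i {w} → (u ∷ us) ‼ i ≡ just w → length w ≡ length u
  chain-level _ zero refl = refl
  chain-level ((_ , _ , |v|≡|u| , _) ∷ chain) (suc i) eq = trans (chain-level chain i eq) |v|≡|u|

  chain-head-≺ : ∀ {u us} → Chain (u ∷ us) → ∀ j {b} → (u ∷ us) ‼ suc j ≡ just b → u ≺ b
  chain-head-≺ ((_ , _ , _ , u≺v , _) ∷ _) zero refl = u≺v
  chain-head-≺ ((_ , _ , _ , u≺v , _) ∷ chain) (suc j) eq = ≺-trans u≺v (chain-head-≺ chain j eq)

  chain-≺ : ∀ {u us} → Chain (u ∷ us) → ∀ i j {a b} → i < j →
    (u ∷ us) ‼ i ≡ just a → (u ∷ us) ‼ j ≡ just b → a ≺ b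
  chain-≺ chain zero (suc j) _ refl eb = chain-head-≺ chain j eb
  chain-≺ (_ ∷ chain) (suc i) (suc j) (s≤s i<j) ea eb = chain-≺ chain i j i<j ea eb

  chain-≼-last : ∀ {u us} → Chain (u ∷ us) → ∀ i {a} → (u ∷ us) ‼ i ≡ just a → a ≼ lastOf u us
  chain-≼-last [-] zero refl = inj₁ refl
  chain-≼-last ((_ , _ , _ , u≺v , _) ∷ chain) zero refl = inj₂ (≺-≼-trans u≺v (chain-≼-last chain zero refl))
  chain-≼-last (_ ∷ chain) (suc i) ea = chain-≼-last chain i ea

  chain-index-injective : ∀ {u us} → Chain (u ∷ us) → ∀ i j {a} →
    (u ∷ us) ‼ i ≡ just a → (u ∷ us) ‼ j ≡ just a → i ≡ j
  chain-index-injective chain i j ea eb with ℕP.<-cmp i j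
  ... | tri< i<j _ _ = ⊥-elim (≺-irrefl (chain-≺ chain i j i<j ea eb))
  ... | tri≈ _ i≡j _ = i≡j
  ... | tri> _ _ j<i = ⊥-elim (≺-irrefl (chain-≺ chain j i j<i eb ea))

  chain-≺⁻ : ∀ {u us} → Chain (u ∷ us) → ∀ i j {a b} →
    (u ∷ us) ‼ i ≡ just a → (u ∷ us) ‼ j ≡ just b → a ≺ b → i < j
  chain-≺⁻ chain i j ea eb a≺b with ℕP.<-cmp i j
  ... | tri< i<j _ _ = i<j
  ... | tri≈ _ refl _ = ⊥-elim (≺-irrefl (subst (_ ≺_) (sym (MaybeP.just-injective (trans (sym ea) eb))) a≺b))
  ... | tri> _ _ j<i = ⊥-elim (≺-asym a≺b (chain-≺ chain j i j<i eb ea))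

  chain-convex : ∀ {u us} → Chain (u ∷ us) → ∀ i j {a b y} → Vertex T y → length y ≡ length u →
    (u ∷ us) ‼ i ≡ just a → (u ∷ us) ‼ j ≡ just b → a ≺ y → y ≺ b → ∃ λ m → (u ∷ us) ‼ m ≡ just y
  chain-convex _ zero zero _ _ refl refl a≺y y≺b = ⊥-elim (≺-asym a≺y y≺b)
  chain-convex {us = v ∷ _} ((_ , _ , |v|≡|u| , _ , nearest) ∷ chain) zero (suc j) {y = y} vy |y|≡|u| refl eb a≺y y≺b
    with ≺-compare y v
  ... | inj₁ y≺v = ⊥-elim (nearest y vy |y|≡|u| a≺y y≺v)
  ... | inj₂ (inj₁ refl) = 1 , refl
  ... | inj₂ (inj₂ v≺y) with chain-convex chain zero j vy (trans |y|≡|u| (sym |v|≡|u|)) refl eb v≺y y≺b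
  ...   | m , em = suc m , em
  chain-convex chain@(_ ∷ _) (suc i) zero _ _ ea refl a≺y y≺b = ⊥-elim (≺-asym (chain-head-≺ chain i ea) (≺-trans a≺y y≺b))
  chain-convex ((_ , _ , |v|≡|u| , _) ∷ chain) (suc i) (suc j) vy |y|≡|u| ea eb a≺y y≺b
    with chain-convex chain i j vy (trans |y|≡|u| (sym |v|≡|u|)) ea eb a≺y y≺b
  ... | m , em = suc m , em

-- The tree T*

module Star (T : Tree) (u₁ : Pos) (rest : List Pos) (allV : All (Vertex T) (u₁ ∷ rest))
            (chain : CousinChain.Chain T (u₁ ∷ rest)) where
  open CousinChain T public

  us : List Pos
  us = u₁ ∷ rest

  T* : Tree
  T* = star T us

  k : ℕ
  k = length u₁

  at-star : ∀ i q {u} → us ‼ i ≡ just u → at T* (i ∷ q) ≡ at T (u ++ q)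
  at-star = go us allV
    where
    go : ∀ us → All (Vertex T) us → ∀ i q {u} → us ‼ i ≡ just u → atL (mapMaybe (at T) us) i q ≡ at T (u ++ q)
    go (u ∷ _) ((_ , eq) ∷ _) zero q refl rewrite eq = sym (at-++ T u eq)
    go (_ ∷ us) ((_ , eq) ∷ vs) (suc i) q ei rewrite eq = go us vs i q ei

  at-star-nothing : ∀ i q → us ‼ i ≡ nothing → at T* (i ∷ q) ≡ nothing
  at-star-nothing = go us allV
    where
    go : ∀ us → All (Vertex T) us → ∀ i q → us ‼ i ≡ nothing → atL (mapMaybe (at T) us) i q ≡ nothing
    go [] _ _ _ _ = refl
    go (_ ∷ us) ((_ , eq) ∷ vs) (suc i) q ei rewrite eq = go us vs i q ei

  Vertex-star⁻ : ∀ {i q} → Vertex T* (i ∷ q) → ∃ λ u → us ‼ i ≡ just u × Vertex T (u ++ q)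
  Vertex-star⁻ {i} {q} (t , eq) with us ‼ i in ei
  ... | just u = u , refl , t , trans (sym (at-star i q ei)) eq
  ... | nothing with trans (sym (at-star-nothing i q ei)) eq
  ...   | ()

  star-index : ∀ {i q} → Vertex T* (i ∷ q) → ∃ λ u → us ‼ i ≡ just u
  star-index v with Vertex-star⁻ v
  ... | u , eq , _ = u , eq

  Vertex-star⁺ : ∀ i {u} q → us ‼ i ≡ just u → Vertex T (u ++ q) → Vertex T* (i ∷ q)
  Vertex-star⁺ i q eq (t , eq′) = t , trans (at-star i q eq) eq′

  Vertex-image : ∀ i {u} q → us ‼ i ≡ just u → Vertex T* (i ∷ q) → Vertex T (u ++ q)
  Vertex-image i q eq (t , eq′) = t , trans (sym (at-star i q eq)) eq′

  ν-star : ∀ i {u} q → us ‼ i ≡ just u → ν T* (i ∷ q) ≡ ν T (u ++ q)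
  ν-star i q eq = cong (maybe size 0) (at-star i q eq)

  length-image : ∀ i {u} q → us ‼ i ≡ just u → length (u ++ q) ≡ k + length q
  length-image i {u} q eq = trans (ListP.length-++ u) (cong (_+ length q) (chain-level chain i eq))

  level-star⁺ : ∀ i j {a b p q} → us ‼ i ≡ just a → us ‼ j ≡ just b →
    length (i ∷ p) ≡ length (j ∷ q) → length (a ++ p) ≡ length (b ++ q)
  level-star⁺ i j {p = p} {q} ea eb |ip|≡|jq| =
    trans (length-image i p ea) (trans (cong (λ z → k + z) (ℕP.suc-injective |ip|≡|jq|)) (sym (length-image j q eb)))

  level-star⁻ : ∀ i j {a b p q} → us ‼ i ≡ just a → us ‼ j ≡ just b →
    length (a ++ p) ≡ length (b ++ q) → length (i ∷ p) ≡ length (j ∷ q)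
  level-star⁻ i j {p = p} {q} ea eb |ap|≡|bq| =
    cong suc (ℕP.+-cancelˡ-≡ k _ _ (trans (sym (length-image i p ea)) (trans |ap|≡|bq| (length-image j q eb))))

  ≺-star⁺ : ∀ i m {a c p r} → us ‼ i ≡ just a → us ‼ m ≡ just c → (i ∷ p) ≺ (m ∷ r) → (a ++ p) ≺ (c ++ r)
  ≺-star⁺ i m {p = p} {r} ea ec (here i<m) =
    ≺-++⁺ p r (trans (chain-level chain i ea) (sym (chain-level chain m ec))) (chain-≺ chain i m i<m ea ec)
  ≺-star⁺ i m {a = a} ea ec (there p≺r) rewrite MaybeP.just-injective (trans (sym ea) ec) = ++-monoʳ-≺ _ p≺r

  ≺-star⁻ : ∀ i m {a c p r} → us ‼ i ≡ just a → us ‼ m ≡ just c → (a ++ p) ≺ (c ++ r) → (i ∷ p) ≺ (m ∷ r)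
  ≺-star⁻ i m {a} {c} ea ec ap≺cr with ≺-++⁻ a c (trans (chain-level chain i ea) (sym (chain-level chain m ec))) ap≺cr
  ... | inj₁ a≺c = here (chain-≺⁻ chain i m ea ec a≺c)
  ... | inj₂ (refl , p≺r) rewrite chain-index-injective chain i m ea ec = there p≺r

  Q-convex : ∀ i j {a b p q} y → Vertex T y → k ≤ length y → us ‼ i ≡ just a → us ‼ j ≡ just b →
    (a ++ p) ≺ y → y ≺ (b ++ q) → ∃₂ λ m c → us ‼ m ≡ just c × y ≡ c ++ drop k y
  Q-convex i j {a} {b} y vy k≤|y| ea eb a≺y y≺b =
    proj₁ y₀-in-chain , y₀ , proj₂ y₀-in-chain , sym y₀++r≡y
    where
    y₀ = take k y
    y₀++r≡y : y₀ ++ drop k y ≡ y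
    y₀++r≡y = ListP.take++drop≡id k y
    |y₀|≡k : length y₀ ≡ k
    |y₀|≡k = trans (ListP.length-take k y) (ℕP.m≤n⇒m⊓n≡m k≤|y|)
    vy₀ : Vertex T y₀
    vy₀ = Vertex-prefix T y₀ (drop k y) (subst (Vertex T) (sym y₀++r≡y) vy)
    y₀-in-chain : ∃ λ m → us ‼ m ≡ just y₀
    y₀-in-chain
      with ≺-++⁻ a y₀ (trans (chain-level chain i ea) (sym |y₀|≡k)) (subst (_ ≺_) (sym y₀++r≡y) a≺y)
         | ≺-++⁻ y₀ b (trans |y₀|≡k (sym (chain-level chain j eb))) (subst (_≺ _) (sym y₀++r≡y) y≺b)
    ... | inj₂ (a≡y₀ , _) | _ = i , subst (λ x → us ‼ i ≡ just x) a≡y₀ ea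
    ... | inj₁ _ | inj₂ (y₀≡b , _) = j , subst (λ x → us ‼ j ≡ just x) (sym y₀≡b) eb
    ... | inj₁ a≺y₀ | inj₁ y₀≺b = chain-convex chain i j vy₀ |y₀|≡k ea eb a≺y₀ y₀≺b

  IsL-star : ∀ i j {p q a b} → IsL T* (i ∷ p) (j ∷ q) → us ‼ i ≡ just a → us ‼ j ≡ just b → IsL T (a ++ p) (b ++ q)
  IsL-star i j {p} {q} {a} {b} (vjq , vip , |ip|≡|jq| , ip≺jq , nearest) ea eb =
    Vertex-image j q eb vjq , Vertex-image i p ea vip , level-star⁺ i j ea eb |ip|≡|jq| ,
    ≺-star⁺ i j ea eb ip≺jq , nearest′
    where
    nearest′ : ∀ y → Vertex T y → length y ≡ length (b ++ q) → (a ++ p) ≺ y → ¬ (y ≺ (b ++ q))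
    nearest′ y vy |y|≡ a≺y y≺b
      with Q-convex i j y vy (subst (k ≤_) (sym (trans |y|≡ (length-image j q eb))) (ℕP.m≤m+n k _)) ea eb a≺y y≺b
    ... | m , c , ec , y≡ =
      nearest (m ∷ drop k y) (Vertex-star⁺ m _ ec (subst (Vertex T) y≡ vy))
        (level-star⁻ m j ec eb (trans (cong length (sym y≡)) |y|≡))
        (≺-star⁻ i m ea ec (subst (_ ≺_) y≡ a≺y)) (≺-star⁻ m j ec eb (subst (_≺ _) y≡ y≺b))

  IsR-star : ∀ i j {p q a b} → IsR T* (i ∷ p) (j ∷ q) → us ‼ i ≡ just a → us ‼ j ≡ just b → IsR T (a ++ p) (b ++ q)
  IsR-star i j r ea eb = IsL⇒IsR (IsL-star j i (IsR⇒IsL r) eb ea)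

  Adjacent-star : ∀ i j {p q a b} → Adjacent T* (i ∷ p) (j ∷ q) → us ‼ i ≡ just a → us ‼ j ≡ just b →
    Adjacent T (a ++ p) (b ++ q)
  Adjacent-star i j (inj₁ l) ea eb = inj₁ (IsL-star i j l ea eb)
  Adjacent-star i j (inj₂ (inj₁ refl)) ea eb = inj₂ (inj₁ (cong (_++ _) (MaybeP.just-injective (trans (sym ea) eb))))
  Adjacent-star i j (inj₂ (inj₂ r)) ea eb = inj₂ (inj₂ (IsR-star i j r ea eb))

module _ {K : ℚ} .{{_ : NonZero K}} {s : ℤ} {T : Tree} (ks : KsTree K s T)
  (u₁ : Pos) (rest : List Pos) (allV : All (Vertex T) (u₁ ∷ rest))
  (chain : CousinChain.Chain T (u₁ ∷ rest)) where
  open Star T u₁ rest allV chain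
  open KsTree ks

  private
    star-T1 : ∀ u a b → IsL T* a u → IsL T* b a → ν T* u ≤ ν T* b + ν T* a
    star-T1 [] a b lau _ = ⊥-elim (¬IsL-of-root a lau)
    star-T1 (_ ∷ _) [] b lau _ = ⊥-elim (¬root-IsL _ lau)
    star-T1 (_ ∷ _) (_ ∷ _) [] _ lba = ⊥-elim (¬root-IsL _ lba)
    star-T1 (j ∷ q) (i ∷ p) (m ∷ r) lau@(vu , va , _) lba@(_ , vb , _)
      with star-index vu | star-index va | star-index vb
    ... | x , ex | y , ey | z , ez rewrite ν-star j q ex | ν-star i p ey | ν-star m r ez =
      T1 (x ++ q) (y ++ p) (z ++ r) (IsL-star i j lau ey ex) (IsL-star m i lba ez ey)

    star-T2 : ∀ u a → IsL T* a u → (ℕ→ℚ (ν T* u) ℚ.÷ K) ℚ.≤ ℕ→ℚ (ν T* a)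
    star-T2 [] a lau = ⊥-elim (¬IsL-of-root a lau)
    star-T2 (_ ∷ _) [] lau = ⊥-elim (¬root-IsL _ lau)
    star-T2 (j ∷ q) (i ∷ p) lau@(vu , va , _) with star-index vu | star-index va
    ... | x , ex | y , ey rewrite ν-star j q ex | ν-star i p ey = T2 (x ++ q) (y ++ p) (IsL-star i j lau ey ex)

    star-NotRightmost : ∀ j q {b} → us ‼ j ≡ just b → NotRightmost T* (j ∷ q) → NotRightmost T (b ++ q)
    star-NotRightmost j q eb ([] , _ , () , _)
    star-NotRightmost j q eb ((m ∷ r) , vmr , |mr|≡|jq| , jq≺mr) with star-index vmr
    ... | c , ec = c ++ r , Vertex-image m r ec vmr , level-star⁺ m j ec eb |mr|≡|jq| , ≺-star⁺ j m eb ec jq≺mr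

    star-T3 : ∀ u → Vertex T* u → NotRightmost T* u →
      ∀ u′ → Vertex T* u′ → (+ L u ℤ.+ s) ℤ.≤ + L u′ → ν T* u′ ≤ ν T* u
    star-T3 [] _ nr = ⊥-elim (root-rightmost nr)
    star-T3 (j ∷ q) vu nr (m ∷ r) vu′ gap with star-index vu | star-index vu′
    ... | b , eb | c , ec rewrite ν-star j q eb | ν-star m r ec =
      T3 (b ++ q) (Vertex-image j q eb vu) (star-NotRightmost j q eb nr) (c ++ r) (Vertex-image m r ec vu′)
        (subst₂ (λ x y → + x ℤ.+ s ℤ.≤ + y) (sym (length-image j q eb)) (sym (length-image m r ec))
          (level-gap-shift s 1 k (length q) (length r) gap))
    star-T3 (j ∷ q) vu nr [] _ gap with star-index vu
    ... | b , eb = ⊥-elim (ℕP.<⇒≱ (s≤s z≤n) (ℤP.drop‿+≤+ (ℤP.≤-trans 1+|q|≤1+|q|+s gap)))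
      where
      1+|q|≤1+|q|+s : + suc (length q) ℤ.≤ + suc (length q) ℤ.+ s
      1+|q|≤1+|q|+s = subst (ℤ._≤ + suc (length q) ℤ.+ s) (ℤP.+-identityʳ (+ suc (length q)))
        (ℤP.+-monoʳ-≤ (+ suc (length q)) {+ 0} {s} (NotRightmost⇒s≥0 ks (b ++ q) (Vertex-image j q eb vu) (star-NotRightmost j q eb nr)))

    star-T4 : ∀ u a → IsL T* a u → HasChild T* u → HasChild T* a
    star-T4 [] a lau _ = ⊥-elim (¬IsL-of-root a lau)
    star-T4 (_ ∷ _) [] lau _ = ⊥-elim (¬root-IsL _ lau)
    star-T4 (j ∷ q) (i ∷ p) lau@(vu , va , _) hc with star-index vu | star-index va
    ... | x , ex | y , ey =
      Vertex-star⁺ i (p ++ [ 0 ]) ey (subst (Vertex T) (ListP.++-assoc y p [ 0 ])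
        (T4 (x ++ q) (y ++ p) (IsL-star i j lau ey ex)
          (subst (Vertex T) (sym (ListP.++-assoc x q [ 0 ])) (Vertex-image j (q ++ [ 0 ]) ex hc))))

  star-KsTree : KsTree K s T*
  star-KsTree = record { T1 = star-T1 ; T2 = star-T2 ; T3 = star-T3 ; T4 = star-T4 }

-- Embedding G^h_{T*} into G^h_T

module Embedding {K : ℚ} .{{_ : NonZero K}} {s : ℤ} {T : Tree} (ks : KsTree K s T)
  (u₁ : Pos) (rest : List Pos) (allV : All (Vertex T) (u₁ ∷ rest))
  (chain : CousinChain.Chain T (u₁ ∷ rest))
  (p₁ pt : Pos) (p₁-parent : Parent u₁ p₁) (pt-parent : Parent (last (u₁ Data.List.NonEmpty.∷ rest)) pt)
  (p₁≡pt⊎l : p₁ ≡ pt ⊎ IsL T p₁ pt) (h : ℕ) where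
  open Star T u₁ rest allV chain

  k′ : ℕ
  k′ = length p₁

  k≡1+k′ : k ≡ suc k′
  k≡1+k′ = trans (cong length (proj₂ p₁-parent)) (length-∷ʳ p₁ (proj₁ p₁-parent))

  private
    ut : Pos
    ut = lastOf u₁ rest

    ut-parent : Parent ut pt
    ut-parent = subst (λ z → Parent z pt) (last≡lastOf u₁ rest) pt-parent

    t : ℕ
    t = proj₁ (‼-lastOf u₁ rest)

    ut-index : us ‼ t ≡ just ut
    ut-index = proj₂ (‼-lastOf u₁ rest)

  |pt|≡k′ : length pt ≡ k′
  |pt|≡k′ = ℕP.suc-injective (trans (sym (length-∷ʳ pt (proj₁ ut-parent)))
    (trans (cong length (sym (proj₂ ut-parent))) (trans (chain-level chain t ut-index) k≡1+k′)))

  Vertex-pt : Vertex T pt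
  Vertex-pt = Vertex-prefix T pt [ proj₁ ut-parent ] (subst (Vertex T) (proj₂ ut-parent) (‼-All allV t ut-index))

  p₁≼pt : p₁ ≼ pt
  p₁≼pt = go p₁≡pt⊎l
    where
    go : p₁ ≡ pt ⊎ IsL T p₁ pt → p₁ ≼ pt
    go (inj₁ p₁≡pt) = inj₁ p₁≡pt
    go (inj₂ (_ , _ , _ , p₁≺pt , _)) = inj₂ p₁≺pt

  length-parent : ∀ i {ca ma} → us ‼ i ≡ just (ca ++ [ ma ]) → length ca ≡ k′
  length-parent i {ca} {ma} ea = ℕP.suc-injective (trans (sym (length-∷ʳ ca ma)) (trans (chain-level chain i ea) k≡1+k′))

  ChainParent : Pos → Set
  ChainParent c = c ≡ p₁ ⊎ c ≡ pt

  -- Chain members lie between u₁ and u_t, so their parents lie weakly between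
  -- p₁ and pt on level k′; as p₁ = pt or p₁ = l(pt), nothing else fits.
  chain-parent : ∀ i {a} → us ‼ i ≡ just a → ∃₂ λ c m → a ≡ c ++ [ m ] × ChainParent c
  chain-parent i {a} ea with ∷ʳ-view a (subst (0 <_) (sym (trans (chain-level chain i ea) k≡1+k′)) (s≤s z≤n))
  ... | c , m , refl = c , m , refl , between (≼-∷ʳ⁻ p₁ c (sym |c|≡k′) p₁m≼cm) (≼-∷ʳ⁻ c pt (trans |c|≡k′ (sym |pt|≡k′)) cm≼ptm)
    where
    |c|≡k′ : length c ≡ k′
    |c|≡k′ = length-parent i ea
    u₁≼a : ∀ i → us ‼ i ≡ just (c ++ [ m ]) → u₁ ≼ (c ++ [ m ])
    u₁≼a zero ea = inj₁ (MaybeP.just-injective ea)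
    u₁≼a (suc i) ea = inj₂ (chain-≺ chain 0 (suc i) (s≤s z≤n) refl ea)
    p₁m≼cm : (p₁ ++ [ proj₁ p₁-parent ]) ≼ (c ++ [ m ])
    p₁m≼cm = subst (_≼ (c ++ [ m ])) (proj₂ p₁-parent) (u₁≼a i ea)
    cm≼ptm : (c ++ [ m ]) ≼ (pt ++ [ proj₁ ut-parent ])
    cm≼ptm = subst ((c ++ [ m ]) ≼_) (proj₂ ut-parent) (chain-≼-last chain i ea)
    strictly-between : p₁ ≺ c → c ≺ pt → p₁ ≡ pt ⊎ IsL T p₁ pt → ⊥
    strictly-between p₁≺c c≺pt (inj₁ refl) = ≺-asym p₁≺c c≺pt
    strictly-between p₁≺c c≺pt (inj₂ (_ , _ , _ , _ , nearest)) =
      nearest c (Vertex-prefix T c [ m ] (‼-All allV i ea)) (trans |c|≡k′ (sym |pt|≡k′)) p₁≺c c≺pt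
    between : p₁ ≼ c → c ≼ pt → ChainParent c
    between (inj₁ p₁≡c) _ = inj₁ (sym p₁≡c)
    between (inj₂ _) (inj₁ c≡pt) = inj₂ c≡pt
    between (inj₂ p₁≺c) (inj₂ c≺pt) = ⊥-elim (strictly-between p₁≺c c≺pt p₁≡pt⊎l)

  ancestors-adjacent : ∀ n → n ≤ k′ → ∀ c c′ → ChainParent c → ChainParent c′ → Adjacent T (take n c′) (take n c)
  ancestors-adjacent n n≤k′ c c′ pc pc′ = from p₁≡pt⊎l
    where
    collapse : ∀ {c} → c ≡ p₁ ⊎ c ≡ p₁ → c ≡ p₁
    collapse (inj₁ eq) = eq
    collapse (inj₂ eq) = eq
    go : take n p₁ ≡ take n pt ⊎ IsL T (take n p₁) (take n pt) →
         ChainParent c → ChainParent c′ → Adjacent T (take n c′) (take n c)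
    go _ (inj₁ refl) (inj₁ refl) = inj₂ (inj₁ refl)
    go _ (inj₂ refl) (inj₂ refl) = inj₂ (inj₁ refl)
    go (inj₁ eq) (inj₂ refl) (inj₁ refl) = inj₂ (inj₁ eq)
    go (inj₂ l) (inj₂ refl) (inj₁ refl) = inj₁ l
    go (inj₁ eq) (inj₁ refl) (inj₂ refl) = inj₂ (inj₁ (sym eq))
    go (inj₂ l) (inj₁ refl) (inj₂ refl) = inj₂ (inj₂ (IsL⇒IsR l))
    from : p₁ ≡ pt ⊎ IsL T p₁ pt → Adjacent T (take n c′) (take n c)
    from (inj₁ refl) = inj₂ (inj₁ (cong (take n) (trans (collapse pc′) (sym (collapse pc)))))
    from (inj₂ lp₁pt) = go (IsL-ancestors ks (k′ ∸ n) n p₁ pt (trans |pt|≡k′ (sym (ℕP.m+[n∸m]≡n n≤k′))) lp₁pt) pc pc′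

  φ : Pos → Pos
  φ [] = pt
  φ (i ∷ q) = maybe (_++ q) pt (us ‼ i)

  φ-∷ : ∀ i q {u} → us ‼ i ≡ just u → φ (i ∷ q) ≡ u ++ q
  φ-∷ i q eq rewrite eq = refl

  φ-⊏ : ∀ i X {a y} → us ‼ i ≡ just a → (i ∷ X) ⊏ y → (a ++ X) ⊏ φ y
  φ-⊏ i X {a} ea (m , r , refl) = m , r , trans (φ-∷ i (X ++ m ∷ r) ea) (sym (ListP.++-assoc a X (m ∷ r)))

  φ-≡ : ∀ i X {a y} → us ‼ i ≡ just a → y ≡ i ∷ X → φ y ≡ a ++ X
  φ-≡ i X ea refl = φ-∷ i X ea

  φ-≡⊎⊏ : ∀ i X {a y} → us ‼ i ≡ just a → (y ≡ i ∷ X ⊎ (i ∷ X) ⊏ y) → (φ y ≡ a ++ X ⊎ (a ++ X) ⊏ φ y)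
  φ-≡⊎⊏ i X ea (inj₁ eq) = inj₁ (φ-≡ i X ea eq)
  φ-≡⊎⊏ i X ea (inj₂ lt) = inj₂ (φ-⊏ i X ea lt)

  length-φ : ∀ i P {a} → us ‼ i ≡ just a → length (φ (i ∷ P)) ≡ k + length P
  length-φ i P ea rewrite φ-∷ i P ea = length-image i P ea

  root-arc : ∀ m r {c} → us ‼ m ≡ just c → Arc T h pt (c ++ r)
  root-arc m r ec with chain-parent m ec
  ... | cc , mc , refl , pcc = go pcc p₁≡pt⊎l
    where
    below-pt : ∀ {cc} → cc ≡ pt → Arc T h pt ((cc ++ [ mc ]) ++ r)
    below-pt refl = G1 (⊏-∷ʳ-++ pt mc r)
    go : ChainParent cc → p₁ ≡ pt ⊎ IsL T p₁ pt → Arc T h pt ((cc ++ [ mc ]) ++ r)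
    go (inj₂ cc≡pt) _ = below-pt cc≡pt
    go (inj₁ cc≡p₁) (inj₁ p₁≡pt) = below-pt (trans cc≡p₁ p₁≡pt)
    go (inj₁ refl) (inj₂ lp₁pt) =
      subst (Arc T h pt) (sym (ListP.++-assoc p₁ [ mc ] r)) (IsL-arc-to-descendants ks h p₁ pt lp₁pt mc r)

  left-chain-arc : ∀ ca ma cb mb w → (cb ++ [ mb ]) ≺ (ca ++ [ ma ]) → length cb ≡ length ca →
    Vertex T (cb ++ [ mb ]) → ChainParent ca → ChainParent cb →
    (w ≡ cb ++ [ mb ] ⊎ (cb ++ [ mb ]) ⊏ w) → Arc T h (ca ++ [ ma ]) w
  left-chain-arc ca ma cb mb w b≺a |cb|≡|ca| vb pca pcb w≼ with ≺-++⁻ cb ca |cb|≡|ca| b≺a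
  ... | inj₂ (refl , here mb<ma) = G2 ca ma mb mb<ma refl vb w≼
  ... | inj₂ (refl , there ())
  ... | inj₁ cb≺ca = go pca pcb p₁≡pt⊎l
    where
    below-p₁ : (w ≡ p₁ ++ [ mb ] ⊎ (p₁ ++ [ mb ]) ⊏ w) → p₁ ⊏ w
    below-p₁ (inj₁ refl) = mb , [] , refl
    below-p₁ (inj₂ (m , r , refl)) = mb , m ∷ r , ListP.++-assoc p₁ [ mb ] (m ∷ r)
    go : ChainParent ca → ChainParent cb → p₁ ≡ pt ⊎ IsL T p₁ pt → Arc T h (ca ++ [ ma ]) w
    go (inj₁ refl) (inj₁ refl) _ = ⊥-elim (≺-irrefl cb≺ca)
    go (inj₂ refl) (inj₂ refl) _ = ⊥-elim (≺-irrefl cb≺ca)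
    go (inj₁ refl) (inj₂ refl) _ = ⊥-elim (≼⇒¬≻ p₁≼pt cb≺ca)
    go (inj₂ refl) (inj₁ refl) (inj₁ refl) = ⊥-elim (≺-irrefl cb≺ca)
    go (inj₂ refl) (inj₁ refl) (inj₂ lp₁pt) = G3 pt p₁ (ma , refl) lp₁pt (inj₂ (below-p₁ w≼))

  anc-inner : ∀ i P → h ≤ length P → anc h (i ∷ P) ≡ i ∷ take (length P ∸ h) P
  anc-inner i P h≤|P| rewrite ℕP.+-∸-assoc 1 h≤|P| = refl

  anc-to-root : ∀ i P → length P < h → anc h (i ∷ P) ≡ []
  anc-to-root i P |P|<h rewrite ℕP.m≤n⇒m∸n≡0 |P|<h = refl

  anc-φ-inner : ∀ i P {a} → us ‼ i ≡ just a → h ≤ length P → anc h (φ (i ∷ P)) ≡ a ++ take (length P ∸ h) P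
  anc-φ-inner i P {a} ea h≤|P| rewrite φ-∷ i P ea =
    begin
      take (length (a ++ P) ∸ h) (a ++ P)
    ≡⟨ cong (λ z → take (z ∸ h) (a ++ P)) (length-image i P ea) ⟩
      take (k + length P ∸ h) (a ++ P)
    ≡⟨ cong (λ z → take z (a ++ P)) (ℕP.+-∸-assoc k h≤|P|) ⟩
      take (k + (length P ∸ h)) (a ++ P)
    ≡⟨ cong (λ z → take (z + (length P ∸ h)) (a ++ P)) (sym (chain-level chain i ea)) ⟩
      take (length a + (length P ∸ h)) (a ++ P)
    ≡⟨ take-length-++ a P (length P ∸ h) ⟩
      a ++ take (length P ∸ h) P
    ∎
    where open ≡-Reasoning

  outer-level≤k′ : ∀ (P : Pos) → length P < h → k + length P ∸ h ≤ k′
  outer-level≤k′ P |P|<h = ℕP.≤-trans (ℕP.∸-monoʳ-≤ {m = suc (length P)} {n = h} (k + length P) |P|<h)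
    (ℕP.≤-reflexive (trans (cong (λ z → z + length P ∸ suc (length P)) k≡1+k′) (ℕP.m+n∸n≡m k′ (length P))))

  anc-φ-outer : ∀ i P {ca ma} → us ‼ i ≡ just (ca ++ [ ma ]) → length P < h →
    anc h (φ (i ∷ P)) ≡ take (k + length P ∸ h) ca
  anc-φ-outer i P {ca} {ma} ea |P|<h rewrite φ-∷ i P ea =
    begin
      take (length ((ca ++ [ ma ]) ++ P) ∸ h) ((ca ++ [ ma ]) ++ P)
    ≡⟨ cong (λ z → take (z ∸ h) ((ca ++ [ ma ]) ++ P)) (length-image i P ea) ⟩
      take n ((ca ++ [ ma ]) ++ P)
    ≡⟨ take-++-≤ n (ca ++ [ ma ]) P (ℕP.≤-trans n≤|ca| (ℕP.≤-trans (ℕP.n≤1+n _) (ℕP.≤-reflexive (sym (length-∷ʳ ca ma))))) ⟩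
      take n (ca ++ [ ma ])
    ≡⟨ take-++-≤ n ca [ ma ] n≤|ca| ⟩
      take n ca
    ∎
    where
    open ≡-Reasoning
    n = k + length P ∸ h
    n≤|ca| : n ≤ length ca
    n≤|ca| = subst (n ≤_) (sym (length-parent i ea)) (outer-level≤k′ P |P|<h)

  length-pt≤ : ∀ i P {a} → us ‼ i ≡ just a → length pt ≤ length (φ (i ∷ P))
  length-pt≤ i P ea = subst₂ _≤_ (sym |pt|≡k′) (sym (length-φ i P ea))
    (subst (λ z → k′ ≤ z + length P) (sym k≡1+k′) (ℕP.≤-trans (ℕP.n≤1+n k′) (ℕP.m≤m+n (suc k′) (length P))))

  -- The h-th ancestor of φ (i ∷ P) lies on a level n ≤ k′ above the parent
  -- of u_i, which is p₁ or pt; by ancestors-adjacent it is next to the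
  -- level-n ancestor of pt, so pt is reached by G4a, G4b or G4c.
  arc-to-pt : ∀ i P {a} → us ‼ i ≡ just a → length P < h → Arc T h (φ (i ∷ P)) pt
  arc-to-pt i P ea |P|<h with chain-parent i ea
  ... | ca , ma , refl , pca = by-level (ℕP.m≤n⇒m<n∨m≡n n≤k′)
    where
    n = k + length P ∸ h
    n≤k′ : n ≤ k′
    n≤k′ = outer-level≤k′ P |P|<h
    adjacent : Adjacent T (take n pt) (anc h (φ (i ∷ P)))
    adjacent = subst (Adjacent T (take n pt)) (sym (anc-φ-outer i P ea |P|<h))
      (ancestors-adjacent n n≤k′ ca pt pca (inj₂ refl))
    at-pt : Adjacent T pt (anc h (φ (i ∷ P))) → Arc T h (φ (i ∷ P)) pt
    at-pt (inj₁ l) = G4b (inj₁ l)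
    at-pt (inj₂ (inj₁ eq)) = G4a eq
    at-pt (inj₂ (inj₂ r)) = G4b (inj₂ r)
    by-level : n < k′ ⊎ n ≡ k′ → Arc T h (φ (i ∷ P)) pt
    by-level (inj₁ n<k′) = G4c (take n pt) adjacent (take-⊏ n pt (subst (n <_) (sym |pt|≡k′) n<k′)) (length-pt≤ i P ea)
    by-level (inj₂ n≡k′) =
      at-pt (subst (λ z → Adjacent T z (anc h (φ (i ∷ P)))) (ListP.take-all n pt (ℕP.≤-reflexive (trans |pt|≡k′ (sym n≡k′)))) adjacent)

  length-φ-mono : ∀ x y → Vertex T* x → Vertex T* y → length y ≤ length x → length (φ y) ≤ length (φ x)
  length-φ-mono [] [] _ _ _ = ℕP.≤-refl
  length-φ-mono (i ∷ P) [] vx _ _ with star-index vx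
  ... | a , ea = length-pt≤ i P ea
  length-φ-mono (i ∷ P) (j ∷ Y) vx vy (s≤s |Y|≤|P|) with star-index vx | star-index vy
  ... | a , ea | b , eb rewrite length-φ i P ea | length-φ j Y eb = ℕP.+-monoʳ-≤ k |Y|≤|P|

  φ-G1 : ∀ x y → Vertex T* x → Vertex T* y → x ⊏ y → Arc T h (φ x) (φ y)
  φ-G1 [] y _ vy (m , r , refl) with star-index vy
  ... | c , ec = subst (Arc T h pt) (sym (φ-∷ m r ec)) (root-arc m r ec)
  φ-G1 (i ∷ P) y vx _ x⊏y with star-index vx
  ... | a , ea = subst (λ z → Arc T h z (φ y)) (sym (φ-∷ i P ea)) (G1 (φ-⊏ i P ea x⊏y))

  φ-G2 : ∀ x y → Vertex T* x → ∀ p i j → j < i → x ≡ p ++ [ i ] → Vertex T* (p ++ [ j ]) →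
    (y ≡ p ++ [ j ] ⊎ (p ++ [ j ]) ⊏ y) → Arc T h (φ x) (φ y)
  φ-G2 x y vx [] i j j<i refl vj y≼ with star-index vx | star-index vj
  ... | a , ea | b , eb with chain-parent i ea | chain-parent j eb
  ... | ca , ma , refl , pca | cb , mb , refl , pcb =
    subst (λ z → Arc T h z (φ y)) (sym (trans (φ-∷ i [] ea) (ListP.++-identityʳ _)))
      (left-chain-arc ca ma cb mb (φ y) (chain-≺ chain j i j<i eb ea)
        (trans (length-parent j eb) (sym (length-parent i ea))) (‼-All allV j eb) pca pcb
        (subst (λ z → φ y ≡ z ⊎ z ⊏ φ y) (ListP.++-identityʳ _) (φ-≡⊎⊏ j [] eb y≼)))
  φ-G2 x y vx (i₀ ∷ p) i j j<i refl vj y≼ with star-index vj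
  ... | a , ea =
    G2 (a ++ p) i j j<i (trans (φ-∷ i₀ (p ++ [ i ]) ea) (sym (ListP.++-assoc a p [ i ])))
      (subst (Vertex T) (sym (ListP.++-assoc a p [ j ])) (Vertex-image i₀ (p ++ [ j ]) ea vj))
      (subst (λ z → φ y ≡ z ⊎ z ⊏ φ y) (sym (ListP.++-assoc a p [ j ])) (φ-≡⊎⊏ i₀ (p ++ [ j ]) ea y≼))

  φ-G3 : ∀ x y p z → Parent x p → IsL T* z p → (y ≡ z ⊎ z ⊏ y) → Arc T h (φ x) (φ y)
  φ-G3 x y [] z _ lzp _ = ⊥-elim (¬IsL-of-root z lzp)
  φ-G3 x y (_ ∷ _) [] _ lzp _ = ⊥-elim (¬root-IsL _ lzp)
  φ-G3 x y (i ∷ P) (j ∷ Z) (m , refl) lzp@(vp , vz , _) y≼ with star-index vp | star-index vz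
  ... | a , ea | b , eb =
    G3 (a ++ P) (b ++ Z) (m , trans (φ-∷ i (P ++ [ m ]) ea) (sym (ListP.++-assoc a P [ m ])))
      (IsL-star j i lzp eb ea) (φ-≡⊎⊏ j Z eb y≼)

  φ-G4a : ∀ x y → Vertex T* x → x ≢ y → y ≡ anc h x → Arc T h (φ x) (φ y)
  φ-G4a [] y _ x≢y y≡ = ⊥-elim (x≢y (sym (trans y≡ (anc-root h))))
  φ-G4a (i ∷ P) y vx _ y≡ with star-index vx | ℕP.≤-<-connex h (length P)
  ... | a , ea | inj₁ h≤|P| =
    G4a (trans (φ-≡ i _ ea (trans y≡ (anc-inner i P h≤|P|))) (sym (anc-φ-inner i P ea h≤|P|)))
  ... | a , ea | inj₂ |P|<h =
    subst (Arc T h (φ (i ∷ P))) (sym (cong φ (trans y≡ (anc-to-root i P |P|<h)))) (arc-to-pt i P ea |P|<h)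

  φ-G4b : ∀ x y → Vertex T* x → Vertex T* y → IsL T* y (anc h x) ⊎ IsR T* y (anc h x) → Arc T h (φ x) (φ y)
  φ-G4b x y vx vy l⊎r = G4b (go x y vx vy l⊎r)
    where
    go : ∀ x y → Vertex T* x → Vertex T* y → IsL T* y (anc h x) ⊎ IsR T* y (anc h x) →
      IsL T (φ y) (anc h (φ x)) ⊎ IsR T (φ y) (anc h (φ x))
    go [] y _ _ l⊎r = ⊥-elim (root-has-no-cousin y (subst (λ z → IsL T* y z ⊎ IsR T* y z) (anc-root h) l⊎r))
    go (i ∷ P) y vx vy l⊎r with ℕP.≤-<-connex h (length P)
    go (i ∷ P) y vx vy l⊎r | inj₂ |P|<h =
      ⊥-elim (root-has-no-cousin y (subst (λ z → IsL T* y z ⊎ IsR T* y z) (anc-to-root i P |P|<h) l⊎r))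
    go (i ∷ P) [] vx vy l⊎r | inj₁ h≤|P| =
      ⊥-elim (root-is-no-cousin _ (subst (λ z → IsL T* [] z ⊎ IsR T* [] z) (anc-inner i P h≤|P|) l⊎r))
    go (i ∷ P) (j ∷ Y) vx vy l⊎r | inj₁ h≤|P| with star-index vx | star-index vy
    ... | a , ea | b , eb rewrite φ-∷ j Y eb | anc-φ-inner i P ea h≤|P| | anc-inner i P h≤|P| =
      ⊎-map (λ l → IsL-star j i l eb ea) (λ r → IsR-star j i r eb ea) l⊎r

  φ-G4c : ∀ x y z → Vertex T* x → Vertex T* y → Adjacent T* z (anc h x) → z ⊏ y → length y ≤ length x →
    Arc T h (φ x) (φ y)
  φ-G4c [] y z _ _ adj (m , r , refl) |y|≤0 with Adjacent-[]ʳ z (subst (Adjacent T* z) (anc-root h) adj)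
  ... | refl = ⊥-elim (ℕP.<⇒≱ (s≤s z≤n) |y|≤0)
  φ-G4c (i ∷ P) y z vx vy adj z⊏y |y|≤ with star-index vx | ℕP.≤-<-connex h (length P)
  ... | a , ea | inj₁ h≤|P| = inner z (subst (Adjacent T* z) (anc-inner i P h≤|P|) adj) z⊏y
    where
    inner : ∀ z → Adjacent T* z (i ∷ take (length P ∸ h) P) → z ⊏ y → Arc T h (φ (i ∷ P)) (φ y)
    inner [] adj _ = ⊥-elim (¬Adjacent-[]ˡ i _ adj)
    inner (j ∷ X) adj z⊏y@(_ , _ , refl) with star-index vy
    ... | b , eb =
      G4c (b ++ X) (subst (Adjacent T (b ++ X)) (sym (anc-φ-inner i P ea h≤|P|)) (Adjacent-star j i adj eb ea))
        (φ-⊏ j X eb z⊏y) (length-φ-mono (i ∷ P) y vx vy |y|≤)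
  ... | a , ea | inj₂ |P|<h with Adjacent-[]ʳ z (subst (Adjacent T* z) (anc-to-root i P |P|<h) adj) | z⊏y
  ...   | refl | m , r , refl with star-index vy
  ...     | c , ec with chain-parent i ea | chain-parent m ec
  ...       | ca , ma , refl , pca | cc , mc , refl , pcc =
    G4c (take n cc) adjacent
      (⊑-⊏-trans (take-⊑ n cc) (subst (cc ⊏_) (sym (φ-∷ m r ec)) (⊏-∷ʳ-++ cc mc r)))
      (length-φ-mono (i ∷ P) (m ∷ r) vx vy |y|≤)
    where
    n = k + length P ∸ h
    adjacent : Adjacent T (take n cc) (anc h (φ (i ∷ P)))
    adjacent = subst (Adjacent T (take n cc)) (sym (anc-φ-outer i P ea |P|<h))
      (ancestors-adjacent n (outer-level≤k′ P |P|<h) ca cc pca pcc)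

  φ-arc : ∀ x y → Vertex T* x → Vertex T* y → x ≢ y → Arc T* h x y → Arc T h (φ x) (φ y)
  φ-arc x y vx vy _ (G1 x⊏y) = φ-G1 x y vx vy x⊏y
  φ-arc x y vx _ _ (G2 p i j j<i x≡ vj y≼) = φ-G2 x y vx p i j j<i x≡ vj y≼
  φ-arc x y _ _ _ (G3 p z px lzp y≼) = φ-G3 x y p z px lzp y≼
  φ-arc x y vx _ x≢y (G4a y≡) = φ-G4a x y vx x≢y y≡
  φ-arc x y vx vy _ (G4b l⊎r) = φ-G4b x y vx vy l⊎r
  φ-arc x y vx vy _ (G4c z adj z⊏y |y|≤) = φ-G4c x y z vx vy adj z⊏y |y|≤

  φ-vertex : ∀ x → Vertex T* x → Vertex T (φ x) × (InQ us (φ x) ⊎ φ x ≡ pt)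
  φ-vertex [] _ = Vertex-pt , inj₂ refl
  φ-vertex (i ∷ q) vx with Vertex-star⁻ vx
  ... | u , eu , vuq = subst (Vertex T) (sym (φ-∷ i q eu)) vuq , inj₁ (‼-Any us i eu (q , φ-∷ i q eu))

  φ-injective : ∀ x y → Vertex T* x → Vertex T* y → φ x ≡ φ y → x ≡ y
  φ-injective [] [] _ _ _ = refl
  φ-injective [] (j ∷ q) _ vy pt≡ with star-index vy
  ... | b , eb = ⊥-elim (pt-too-short q (trans (cong length pt≡) (length-φ j q eb)))
    where
    pt-too-short : ∀ q → ¬ (length pt ≡ k + length q)
    pt-too-short q eq = ℕP.m≢1+m+n k′ (trans (sym |pt|≡k′) (trans eq (cong (_+ length q) k≡1+k′)))
  φ-injective (i ∷ p) [] vx vy ≡pt = sym (φ-injective [] (i ∷ p) vy vx (sym ≡pt))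
  φ-injective (i ∷ p) (j ∷ q) vx vy φx≡φy with star-index vx | star-index vy
  ... | a , ea | b , eb
    with ++-cancel-≡length a b (trans (chain-level chain i ea) (sym (chain-level chain j eb)))
           (trans (sym (φ-∷ i p ea)) (trans φx≡φy (φ-∷ j q eb)))
  ... | refl , refl = cong (_∷ p) (chain-index-injective chain i j ea eb)

  φ-edge : ∀ x y → Edge T* h x y → Edge T h (φ x) (φ y)
  φ-edge x y (vx , vy , x≢y , x→y⊎y→x) =
    proj₁ (φ-vertex x vx) , proj₁ (φ-vertex y vy) , (λ eq → x≢y (φ-injective x y vx vy eq)) , arcs x→y⊎y→x
    where
    arcs : Arc T* h x y ⊎ Arc T* h y x → Arc T h (φ x) (φ y) ⊎ Arc T h (φ y) (φ x)
    arcs (inj₁ x→y) = inj₁ (φ-arc x y vx vy x≢y x→y)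
    arcs (inj₂ y→x) = inj₂ (φ-arc y x vy vx (λ eq → x≢y (sym eq)) y→x)

lemma5p3 : (K : ℚ) .{{_ : NonZero K}} (s : ℤ) (T : Tree) → KsTree K s T →
    (u₁ : Pos) (rest : List Pos) →
    All (Vertex T) (u₁ ∷ rest) →
    Linked (λ a b → IsR T b a) (u₁ ∷ rest) →
    KsTree K s (star T (u₁ ∷ rest)) ×
    (∀ p₁ pt → Parent u₁ p₁ → Parent (last (u₁ Data.List.NonEmpty.∷ rest)) pt →
      (p₁ ≡ pt ⊎ IsL T p₁ pt) →
      ∀ (h : ℕ) → Σ (Pos → Pos) λ φ →
        φ Data.List.[] ≡ pt ×
        (∀ x → Vertex (star T (u₁ ∷ rest)) x →
          Vertex T (φ x) × (InQ (u₁ ∷ rest) (φ x) ⊎ φ x ≡ pt)) ×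
        (∀ x y → Vertex (star T (u₁ ∷ rest)) x → Vertex (star T (u₁ ∷ rest)) y →
          φ x ≡ φ y → x ≡ y) ×
        (∀ x y → Edge (star T (u₁ ∷ rest)) h x y → Edge T h (φ x) (φ y)))
lemma5p3 K s T ks u₁ rest allV chain =
  star-KsTree ks u₁ rest allV chain ,
  λ p₁ pt p₁-parent pt-parent p₁≡pt⊎l h →
    let open Embedding ks u₁ rest allV chain p₁ pt p₁-parent pt-parent p₁≡pt⊎l h
    in φ , refl , φ-vertex , φ-injective , φ-edge
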